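{- Let $G=(V,E)$ be a graph with a partition $\Gamma=\{E_1,\ldots,E_\gamma\}$ of $E$ into nonempty groups, and let $H=(V,E')$ be the subgraph with edge set $E'=\bigcup_{j=1}^k E_{s_j}$ for some indices $s_1,\ldots,s_k\in[\gamma]$ ($k\ge1$). Then, with edge utilities, $\mathrm{DF\text{ - }MP}(G,\Gamma)\le\mathrm{MP}(H)$.
   Context: Max-Cut with edge utilities: for a finite simple graph $G=(V,E)$, a cut is a subset $S\subseteq V$; for an edge $e$, $X_e(S)=1$ if $e$ has exactly one endpoint in $S$ and $0$ otherwise, and $f_S(F)=\sum_{e\in F}X_e(S)$ for $F\subseteq E$. For a graph $H=(V,E')$ with $E'\neq\emptyset$, $\mathrm{MP}(H)=\max_{S\subseteq V}f_S(E')/|E'|$. For a partition $\Gamma=\{E_1,\ldots,E_\gamma\}$ of $E$, $\mathrm{DF\text{ - }MP}(G,\Gamma)=\max_{D}\min_{i\in[\gamma]}\mathbb{E}_{S\sim D}f_S(E_i)/|E_i|$, the maximum being over all probability distributions $D$ on the subsets of $V$.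
   Formalization: The probability distributions D on the subsets of V, over which DF-MP(G,Γ) is maximized, take only rational weights. -}

module Defs where

open import Data.Nat as ℕ using (ℕ; zero; suc)
open import Data.Integer using (+_)
open import Data.Rational using (ℚ; 0ℚ; 1ℚ; _/_; _+_; _*_; _⊔_; _⊓_; _≤_)
open import Data.Fin using (Fin; zero; suc; _≟_)
open import Data.Fin.Subset using (Subset)
open import Data.Vec using ([]; _∷_; lookup)
open import Data.Bool using (Bool; true; false; if_then_else_; _xor_)
open import Data.List using (List; []; _∷_; map; _++_; foldr; allFin)
open import Data.Bool.ListAction using (any)
open import Data.Product using (_×_; _,_; proj₁; proj₂)
open import Data.Sum using (_⊎_)
open import Relation.Nullary.Decidable using (⌊_⌋)
open import Relation.Binary.PropositionalEquality using (_≡_; _≢_)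

record SimpleGraph (n m : ℕ) : Set where
  field
    ends     : Fin m → Fin n × Fin n
    loopless : ∀ e → proj₁ (ends e) ≢ proj₂ (ends e)
    noMulti  : ∀ e e′ →
               ((proj₁ (ends e) ≡ proj₁ (ends e′) × proj₂ (ends e) ≡ proj₂ (ends e′))
                ⊎ (proj₁ (ends e) ≡ proj₂ (ends e′) × proj₂ (ends e) ≡ proj₁ (ends e′)))
               → e ≡ e′
open SimpleGraph public

EdgeSet : ℕ → Set
EdgeSet m = Fin m → Bool

sumFin : (m : ℕ) → (Fin m → ℕ) → ℕ
sumFin zero    g = 0
sumFin (suc m) g = g zero ℕ.+ sumFin m (λ i → g (suc i))

card : {m : ℕ} → EdgeSet m → ℕ
card {m} F = sumFin m (λ e → if F e then 1 else 0)

X : {n m : ℕ} → SimpleGraph n m → Fin m → Subset n → ℕ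
X G e S = if lookup S (proj₁ (ends G e)) xor lookup S (proj₂ (ends G e)) then 1 else 0

f : {n m : ℕ} → SimpleGraph n m → Subset n → EdgeSet m → ℕ
f {n} {m} G S F = sumFin m (λ e → if F e then X G e S else 0)

-- a / b as a rational; convention a / 0 = 0 (only ever used with b ≠ 0
-- under the hypotheses of the statement).
frac : ℕ → ℕ → ℚ
frac a zero    = 0ℚ
frac a (suc b) = (+ a) / suc b

allCuts : (n : ℕ) → List (Subset n)
allCuts zero    = [] ∷ []
allCuts (suc n) = map (true ∷_) (allCuts n) ++ map (false ∷_) (allCuts n)

maxList : List ℚ → ℚ
maxList = foldr _⊔_ 0ℚ

-- MP(H) = max_S f_S(E')/|E'| for the graph H = (V, E') where E' ⊆ E.
MP : {n m : ℕ} → SimpleGraph n m → EdgeSet m → ℚ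
MP {n} G E′ = maxList (map (λ S → frac (f G S E′) (card E′)) (allCuts n))

-- Probability distributions on cuts: finitely supported, rational weights,
-- given as a list of (weight, cut) pairs (repetitions allowed).

Dist : ℕ → Set
Dist n = List (ℚ × Subset n)

totalWeight : {n : ℕ} → Dist n → ℚ
totalWeight = foldr (λ p acc → proj₁ p + acc) 0ℚ

data AllNonneg {n : ℕ} : Dist n → Set where
  []  : AllNonneg []
  _∷_ : ∀ {w S D} → 0ℚ ≤ w → AllNonneg D → AllNonneg ((w , S) ∷ D)

IsDistribution : {n : ℕ} → Dist n → Set
IsDistribution D = AllNonneg D × totalWeight D ≡ 1ℚ

expect : {n : ℕ} → Dist n → (Subset n → ℚ) → ℚ
expect D g = foldr (λ p acc → proj₁ p * g (proj₂ p) + acc) 0ℚ D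

-- Minimum over i ∈ [γ] (value 0 for γ = 0, never used: γ ≥ 1 below).
minFin : (γ : ℕ) → (Fin γ → ℚ) → ℚ
minFin zero          h = 0ℚ
minFin (suc zero)    h = h zero
minFin (suc (suc γ)) h = h zero ⊓ minFin (suc γ) (λ i → h (suc i))

-- Partition Γ = {E_1,…,E_γ} of E encoded by the group map grp : E → [γ];
-- group E_i = { e | grp e = i }.
group : {m γ : ℕ} → (Fin m → Fin γ) → Fin γ → EdgeSet m
group grp i e = ⌊ grp e ≟ i ⌋

unionGroups : {m γ k : ℕ} → (Fin m → Fin γ) → (Fin k → Fin γ) → EdgeSet m
unionGroups {k = k} grp s e = any (λ j → ⌊ grp e ≟ s j ⌋) (allFin k)

dfValue : {n m : ℕ} → SimpleGraph n m → (γ : ℕ) → (Fin m → Fin γ) → Dist n → ℚ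
dfValue G γ grp D =
  minFin γ (λ i → expect D (λ S → frac (f G S (group grp i)) (card (group grp i))))

{-# OPTIONS --safe #-}
module Submission where

open import Defs
open import Data.Nat using (ℕ; suc)
open import Data.Fin using (Fin)
open import Data.Product using (∃)
open import Data.Rational using (_≤_)
open import Relation.Binary.PropositionalEquality using (_≡_)

open import Algebra.Bundles using (CommutativeMonoid)
import Algebra.Properties.CommutativeSemigroup as CommutativeSemigroupProperties
import Algebra.Properties.CommutativeMonoid.Sum as CommutativeMonoidSum
open import Data.Bool using (Bool; true; false; T; if_then_else_)
open import Data.Bool.ListAction using (any)
open import Data.Fin using (zero; suc; _≟_)
open import Data.Fin.Subset using (Subset)
import Data.Integer as ℤ
import Data.Integer.Properties as ℤ
open import Data.List using (List; []; _∷_; map; allFin)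
open import Data.List.Membership.Propositional using (_∈_)
open import Data.List.Membership.Propositional.Properties
  using (∈-map⁺; ∈-++⁺ˡ; ∈-++⁺ʳ; ∈-allFin)
import Data.List.Relation.Unary.Any as Any
open import Data.List.Relation.Unary.Any.Properties using (any⁺)
open import Data.Nat using (zero)
import Data.Nat as ℕ
import Data.Nat.Properties as ℕ
open import Data.Product using (_,_; proj₁; proj₂)
open import Data.Rational
  using (ℚ; 0ℚ; 1ℚ; _+_; _*_; _/_; NonNegative; Positive; nonNegative; toℚᵘ)
import Data.Rational.Properties as ℚ
open import Data.Rational.Unnormalised using (mkℚᵘ; *≡*)
  renaming (_≃_ to _≃ᵘ_; _+_ to _+ᵘ_; _*_ to _*ᵘ_)
import Data.Rational.Unnormalised.Properties as ℚᵘ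
open import Data.Vec using (_∷_; [])
open import Function.Bundles using (_⇔_; mk⇔; Equivalence)
open import Relation.Binary.PropositionalEquality
  using (refl; sym; trans; cong; cong₂; module ≡-Reasoning)
open import Relation.Nullary using (yes; no)
open import Relation.Nullary.Decidable using (⌊_⌋; fromWitness)

-- Let v be the DF objective of D. Every group E_i gets expected cut ratio at least v, i.e.
-- v |E_i| ≤ E f_S(E_i) (E_i ≠ ∅). Inequalities of the form v c ≤ E g are closed under
-- sums, and since the groups partition E, both |E′| and f_S(E′) are sums over the
-- selected groups; so v |E′| ≤ E f_S(E′), i.e. v ≤ E f_S(E′)/|E′|. Finally, an average
-- of cut ratios of H is at most the largest one, MP(H).

module ℕ-Sum = CommutativeMonoidSum ℕ.+-0-commutativeMonoid

sumFin-cong : ∀ m {g h : Fin m → ℕ} → (∀ i → g i ≡ h i) → sumFin m g ≡ sumFin m h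
sumFin-cong zero    g≗h = refl
sumFin-cong (suc m) g≗h = cong₂ ℕ._+_ (g≗h zero) (sumFin-cong m (λ i → g≗h (suc i)))

sumFin≡sum : ∀ m (g : Fin m → ℕ) → sumFin m g ≡ ℕ-Sum.sum g
sumFin≡sum zero    g = refl
sumFin≡sum (suc m) g = cong (g zero ℕ.+_) (sumFin≡sum m (λ i → g (suc i)))

sumFin-zero : ∀ m → sumFin m (λ _ → 0) ≡ 0
sumFin-zero m = trans (sumFin≡sum m _) (ℕ-Sum.sum-replicate-zero m)

sumFin-comm : ∀ k m (A : Fin k → Fin m → ℕ) →
  sumFin k (λ i → sumFin m (A i)) ≡ sumFin m (λ e → sumFin k (λ i → A i e))
sumFin-comm k m A = begin
  sumFin k (λ i → sumFin m (A i))            ≡⟨ sumFin-cong k (λ i → sumFin≡sum m (A i)) ⟩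
  sumFin k (λ i → ℕ-Sum.sum (A i))           ≡⟨ sumFin≡sum k _ ⟩
  ℕ-Sum.sum (λ i → ℕ-Sum.sum (A i))          ≡⟨ ℕ-Sum.∑-comm A ⟩
  ℕ-Sum.sum (λ e → ℕ-Sum.sum (λ i → A i e))  ≡⟨ sumFin≡sum m _ ⟨
  sumFin m (λ e → ℕ-Sum.sum (λ i → A i e))   ≡⟨ sumFin-cong m (λ e → sumFin≡sum k (λ i → A i e)) ⟨
  sumFin m (λ e → sumFin k (λ i → A i e))    ∎
  where open ≡-Reasoning

sumFin-δ : ∀ k (j : Fin k) x → sumFin k (λ i → if ⌊ j ≟ i ⌋ then x else 0) ≡ x
sumFin-δ (suc k) zero    x = trans (cong (x ℕ.+_) (sumFin-zero k)) (ℕ.+-identityʳ x)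
sumFin-δ (suc k) (suc j) x = trans (sumFin-cong k suc-case) (sumFin-δ k j x)
  where
  suc-case : ∀ i → (if ⌊ suc j ≟ suc i ⌋ then x else 0) ≡ (if ⌊ j ≟ i ⌋ then x else 0)
  suc-case i with j ≟ i
  ... | yes _ = refl
  ... | no  _ = refl

-- f G S F and card F are, by definition, sumOver F (λ e → X G e S) and sumOver F (λ _ → 1).
sumOver : ∀ {k} → (Fin k → Bool) → (Fin k → ℕ) → ℕ
sumOver {k} t h = sumFin k (λ i → if t i then h i else 0)

sumOver-partition : ∀ {m γ} (grp : Fin m → Fin γ) (t : Fin γ → Bool) (h : Fin m → ℕ) →
  sumOver (λ e → t (grp e)) h ≡ sumOver t (λ i → sumOver (group grp i) h)
sumOver-partition {m} {γ} grp t h = sym (begin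
  sumFin γ (λ i → if t i then sumFin m (λ e → [ grp e ≟ i ] h e) else 0)
    ≡⟨ sumFin-cong γ (λ i → if-sumFin (t i)) ⟩
  sumFin γ (λ i → sumFin m (λ e → if t i then [ grp e ≟ i ] h e else 0))
    ≡⟨ sumFin-cong γ (λ i → sumFin-cong m (λ e → swap-ifs (grp e) i)) ⟩
  sumFin γ (λ i → sumFin m (λ e → [ grp e ≟ i ] (if t (grp e) then h e else 0)))
    ≡⟨ sumFin-comm γ m _ ⟩
  sumFin m (λ e → sumFin γ (λ i → [ grp e ≟ i ] (if t (grp e) then h e else 0)))
    ≡⟨ sumFin-cong m (λ e → sumFin-δ γ (grp e) _) ⟩
  sumFin m (λ e → if t (grp e) then h e else 0)
    ∎)
  where
  open ≡-Reasoning
  [_≟_]_ : Fin γ → Fin γ → ℕ → ℕ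
  [ j ≟ i ] x = if ⌊ j ≟ i ⌋ then x else 0
  if-sumFin : ∀ {A : Fin m → ℕ} b →
    (if b then sumFin m A else 0) ≡ sumFin m (λ e → if b then A e else 0)
  if-sumFin true  = refl
  if-sumFin false = sym (sumFin-zero m)
  swap-ifs : ∀ {x} j i → (if t i then [ j ≟ i ] x else 0) ≡ [ j ≟ i ] (if t j then x else 0)
  swap-ifs j i with j ≟ i
  ... | yes refl = refl
  ... | no  _    with t i
  ...   | true  = refl
  ...   | false = refl

fromℕ : ℕ → ℚ
fromℕ a = ℤ.+ a / 1

fromℕ-nonNeg : ∀ a → NonNegative (fromℕ a)
fromℕ-nonNeg a = ℚ.normalize-nonNeg a 1

fromℕ-pos : ∀ b → Positive (fromℕ (suc b))
fromℕ-pos b = ℚ.normalize-pos (suc b) 1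

-- Also covers fromℕ a, which is frac a 1 by definition.
toℚᵘ-frac : ∀ a b → toℚᵘ (frac a (suc b)) ≃ᵘ mkℚᵘ (ℤ.+ a) b
toℚᵘ-frac a b = ℚ.toℚᵘ-fromℚᵘ (mkℚᵘ (ℤ.+ a) b)

fromℕ-+ : ∀ a b → fromℕ (a ℕ.+ b) ≡ fromℕ a + fromℕ b
fromℕ-+ a b = ℚ.toℚᵘ-injective (begin
  toℚᵘ (fromℕ (a ℕ.+ b))             ≈⟨ toℚᵘ-frac (a ℕ.+ b) 0 ⟩
  mkℚᵘ (ℤ.+ (a ℕ.+ b)) 0             ≈⟨ *≡* cross-multiplied ⟩
  mkℚᵘ (ℤ.+ a) 0 +ᵘ mkℚᵘ (ℤ.+ b) 0   ≈⟨ ℚᵘ.+-cong (toℚᵘ-frac a 0) (toℚᵘ-frac b 0) ⟨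
  toℚᵘ (fromℕ a) +ᵘ toℚᵘ (fromℕ b)   ≈⟨ ℚ.toℚᵘ-homo-+ (fromℕ a) (fromℕ b) ⟨
  toℚᵘ (fromℕ a + fromℕ b)           ∎)
  where
  open ℚᵘ.≃-Reasoning
  cross-multiplied :
    ℤ.+ (a ℕ.+ b) ℤ.* ℤ.+ 1 ≡ (ℤ.+ a ℤ.* ℤ.+ 1 ℤ.+ ℤ.+ b ℤ.* ℤ.+ 1) ℤ.* ℤ.+ 1
  cross-multiplied rewrite ℤ.*-identityʳ (ℤ.+ a) | ℤ.*-identityʳ (ℤ.+ b) =
    cong (ℤ._* ℤ.+ 1) (ℤ.pos-+ a b)

frac-*-denominator : ∀ a b → frac a (suc b) * fromℕ (suc b) ≡ fromℕ a
frac-*-denominator a b = ℚ.toℚᵘ-injective (begin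
  toℚᵘ (frac a (suc b) * fromℕ (suc b))
    ≈⟨ ℚ.toℚᵘ-homo-* (frac a (suc b)) (fromℕ (suc b)) ⟩
  toℚᵘ (frac a (suc b)) *ᵘ toℚᵘ (fromℕ (suc b))
    ≈⟨ ℚᵘ.*-cong (toℚᵘ-frac a b) (toℚᵘ-frac (suc b) 0) ⟩
  mkℚᵘ (ℤ.+ a) b *ᵘ mkℚᵘ (ℤ.+ suc b) 0
    ≈⟨ *≡* (ℤ.*-assoc (ℤ.+ a) (ℤ.+ suc b) (ℤ.+ 1)) ⟩
  mkℚᵘ (ℤ.+ a) 0
    ≈⟨ toℚᵘ-frac a 0 ⟨
  toℚᵘ (fromℕ a)
    ∎)
  where open ℚᵘ.≃-Reasoning

module _ {n : ℕ} where

  expect-cong : (D : Dist n) {g h : Subset n → ℚ} →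
    (∀ S → g S ≡ h S) → expect D g ≡ expect D h
  expect-cong []            g≗h = refl
  expect-cong ((w , S) ∷ D) g≗h = cong₂ _+_ (cong (w *_) (g≗h S)) (expect-cong D g≗h)

  expect-zero : (D : Dist n) → expect D (λ _ → 0ℚ) ≡ 0ℚ
  expect-zero []            = refl
  expect-zero ((w , S) ∷ D) = cong₂ _+_ (ℚ.*-zeroʳ w) (expect-zero D)

  expect-+ : (D : Dist n) (g h : Subset n → ℚ) →
    expect D (λ S → g S + h S) ≡ expect D g + expect D h
  expect-+ []            g h = refl
  expect-+ ((w , S) ∷ D) g h = begin
    w * (g S + h S) + expect D (λ S → g S + h S)
      ≡⟨ cong₂ _+_ (ℚ.*-distribˡ-+ w (g S) (h S)) (expect-+ D g h) ⟩
    (w * g S + w * h S) + (expect D g + expect D h)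
      ≡⟨ +-interchange (w * g S) (w * h S) (expect D g) (expect D h) ⟩
    (w * g S + expect D g) + (w * h S + expect D h)
      ∎
    where
    open ≡-Reasoning
    open CommutativeSemigroupProperties
      (CommutativeMonoid.commutativeSemigroup ℚ.+-0-commutativeMonoid)
      using () renaming (interchange to +-interchange)

  expect-*ʳ : (D : Dist n) (g : Subset n → ℚ) (r : ℚ) →
    expect D (λ S → g S * r) ≡ expect D g * r
  expect-*ʳ []            g r = sym (ℚ.*-zeroˡ r)
  expect-*ʳ ((w , S) ∷ D) g r = begin
    w * (g S * r) + expect D (λ S → g S * r)
      ≡⟨ cong₂ _+_ (sym (ℚ.*-assoc w (g S) r)) (expect-*ʳ D g r) ⟩
    w * g S * r + expect D g * r
      ≡⟨ ℚ.*-distribʳ-+ r (w * g S) (expect D g) ⟨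
    (w * g S + expect D g) * r
      ∎
    where open ≡-Reasoning

  expect-≤-totalWeight* : (D : Dist n) → AllNonneg D → (g : Subset n → ℚ) (M : ℚ) →
    (∀ S → g S ≤ M) → expect D g ≤ totalWeight D * M
  expect-≤-totalWeight* []            []          g M g≤M = ℚ.≤-reflexive (sym (ℚ.*-zeroˡ M))
  expect-≤-totalWeight* ((w , S) ∷ D) (0≤w ∷ D≥0) g M g≤M = begin
    w * g S + expect D g
      ≤⟨ ℚ.+-mono-≤ (ℚ.*-monoˡ-≤-nonNeg w {{nonNegative 0≤w}} (g≤M S))
                    (expect-≤-totalWeight* D D≥0 g M g≤M) ⟩
    w * M + totalWeight D * M
      ≡⟨ ℚ.*-distribʳ-+ M w (totalWeight D) ⟨
    (w + totalWeight D) * M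
      ∎
    where open ℚ.≤-Reasoning

  expect-≤ : {D : Dist n} → IsDistribution D → {g : Subset n → ℚ} {M : ℚ} →
    (∀ S → g S ≤ M) → expect D g ≤ M
  expect-≤ {D} (D≥0 , total≡1) {g} {M} g≤M = begin
    expect D g         ≤⟨ expect-≤-totalWeight* D D≥0 g M g≤M ⟩
    totalWeight D * M  ≡⟨ cong (_* M) total≡1 ⟩
    1ℚ * M             ≡⟨ ℚ.*-identityˡ M ⟩
    M                  ∎
    where open ℚ.≤-Reasoning

  expect-frac-*-denominator : (D : Dist n) (g : Subset n → ℕ) (b : ℕ) →
    expect D (λ S → frac (g S) (suc b)) * fromℕ (suc b) ≡ expect D (λ S → fromℕ (g S))
  expect-frac-*-denominator D g b =
    trans (sym (expect-*ʳ D _ _)) (expect-cong D (λ S → frac-*-denominator (g S) b))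

module _ {n : ℕ} (D : Dist n) (v : ℚ) where

  -- A record rather than a synonym, so that c and g can be inferred from it.
  record RateAtLeast (c : ℕ) (g : Subset n → ℕ) : Set where
    constructor rateAtLeast
    field
      scaled≤expect : v * fromℕ c ≤ expect D (λ S → fromℕ (g S))

  rateAtLeast-cong : ∀ {c c′} {g g′ : Subset n → ℕ} → c ≡ c′ → (∀ S → g S ≡ g′ S) →
    RateAtLeast c g → RateAtLeast c′ g′
  rateAtLeast-cong refl g≗g′ (rateAtLeast v*c≤) =
    rateAtLeast (ℚ.≤-trans v*c≤ (ℚ.≤-reflexive (expect-cong D (λ S → cong fromℕ (g≗g′ S)))))

  rateAtLeast-zero : RateAtLeast 0 (λ _ → 0)
  rateAtLeast-zero = rateAtLeast (ℚ.≤-reflexive (trans (ℚ.*-zeroʳ v) (sym (expect-zero D))))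

  rateAtLeast-+ : ∀ {c c′} {g g′ : Subset n → ℕ} → RateAtLeast c g → RateAtLeast c′ g′ →
    RateAtLeast (c ℕ.+ c′) (λ S → g S ℕ.+ g′ S)
  rateAtLeast-+ {c} {c′} {g} {g′} (rateAtLeast v*c≤) (rateAtLeast v*c′≤) = rateAtLeast (begin
    v * fromℕ (c ℕ.+ c′)
      ≡⟨ cong (v *_) (fromℕ-+ c c′) ⟩
    v * (fromℕ c + fromℕ c′)
      ≡⟨ ℚ.*-distribˡ-+ v (fromℕ c) (fromℕ c′) ⟩
    v * fromℕ c + v * fromℕ c′
      ≤⟨ ℚ.+-mono-≤ v*c≤ v*c′≤ ⟩
    expect D (λ S → fromℕ (g S)) + expect D (λ S → fromℕ (g′ S))
      ≡⟨ expect-+ D _ _ ⟨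
    expect D (λ S → fromℕ (g S) + fromℕ (g′ S))
      ≡⟨ expect-cong D (λ S → fromℕ-+ (g S) (g′ S)) ⟨
    expect D (λ S → fromℕ (g S ℕ.+ g′ S))
      ∎)
    where open ℚ.≤-Reasoning

  rateAtLeast-sumOver : ∀ {k} (t : Fin k → Bool) {c : Fin k → ℕ} {g : Fin k → Subset n → ℕ} →
    (∀ i → RateAtLeast (c i) (g i)) →
    RateAtLeast (sumOver t c) (λ S → sumOver t (λ i → g i S))
  rateAtLeast-sumOver {zero}  t rates = rateAtLeast-zero
  rateAtLeast-sumOver {suc k} t {c} {g} rates =
    rateAtLeast-+ (if-rate (t zero)) (rateAtLeast-sumOver (λ i → t (suc i)) (λ i → rates (suc i)))
    where
    if-rate : ∀ b → RateAtLeast (if b then c zero else 0) (λ S → if b then g zero S else 0)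
    if-rate true  = rates zero
    if-rate false = rateAtLeast-zero

  ≤-expect-frac⇔rateAtLeast : ∀ {c} (g : Subset n → ℕ) → 0 ℕ.< c →
    v ≤ expect D (λ S → frac (g S) c) ⇔ RateAtLeast c g
  ≤-expect-frac⇔rateAtLeast {suc b} g _ = mk⇔
    (λ v≤ → rateAtLeast (ℚ.≤-trans
      (ℚ.*-monoʳ-≤-nonNeg (fromℕ (suc b)) {{fromℕ-nonNeg (suc b)}} v≤)
      (ℚ.≤-reflexive (expect-frac-*-denominator D g b))))
    (λ (rateAtLeast v*c≤) → ℚ.*-cancelʳ-≤-pos (fromℕ (suc b)) {{fromℕ-pos b}}
      (ℚ.≤-trans v*c≤ (ℚ.≤-reflexive (sym (expect-frac-*-denominator D g b)))))

rateAtLeast-union : ∀ {n m γ} (G : SimpleGraph n m) (grp : Fin m → Fin γ) (t : Fin γ → Bool)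
  (D : Dist n) (v : ℚ) →
  (∀ i → RateAtLeast D v (card (group grp i)) (λ S → f G S (group grp i))) →
  RateAtLeast D v (card (λ e → t (grp e))) (λ S → f G S (λ e → t (grp e)))
rateAtLeast-union G grp t D v rates =
  rateAtLeast-cong D v (sym (sumOver-partition grp t (λ _ → 1)))
                       (λ S → sym (sumOver-partition grp t (λ e → X G e S)))
                       (rateAtLeast-sumOver D v t rates)

card-pos : ∀ {m} (F : EdgeSet m) e → T (F e) → 0 ℕ.< card F
card-pos F zero Fe with F zero
card-pos F zero Fe | true  = ℕ.s≤s ℕ.z≤n
card-pos F zero () | false
card-pos F (suc e) Fe =
  ℕ.<-≤-trans (card-pos (λ e → F (suc e)) e Fe) (ℕ.m≤n+m _ (if F zero then 1 else 0))

∈-group : ∀ {m γ} (grp : Fin m → Fin γ) {e i} → grp e ≡ i → T (group grp i e)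
∈-group grp = fromWitness

∈-unionGroups : ∀ {m γ k} (grp : Fin m → Fin γ) (s : Fin k → Fin γ) {e} j →
  grp e ≡ s j → T (unionGroups grp s e)
∈-unionGroups grp s j grp[e]≡s[j] =
  any⁺ _ (Any.map (λ { refl → fromWitness grp[e]≡s[j] }) (∈-allFin j))

≤-maxList : ∀ {A : Set} (g : A → ℚ) {xs : List A} {x} → x ∈ xs → g x ≤ maxList (map g xs)
≤-maxList g {y ∷ xs} (Any.here refl)  = ℚ.p≤p⊔q (g y) _
≤-maxList g {y ∷ xs} (Any.there x∈xs) = ℚ.≤-trans (≤-maxList g x∈xs) (ℚ.p≤q⊔p (g y) _)

∈-allCuts : ∀ {n} (S : Subset n) → S ∈ allCuts n
∈-allCuts []                  = Any.here refl
∈-allCuts (true ∷ S)          = ∈-++⁺ˡ (∈-map⁺ (true ∷_) (∈-allCuts S))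
∈-allCuts {suc n} (false ∷ S) =
  ∈-++⁺ʳ (map (true ∷_) (allCuts n)) (∈-map⁺ (false ∷_) (∈-allCuts S))

cutRatio-≤-MP : ∀ {n m} (G : SimpleGraph n m) (F : EdgeSet m) (S : Subset n) →
  frac (f G S F) (card F) ≤ MP G F
cutRatio-≤-MP G F S = ≤-maxList (λ S → frac (f G S F) (card F)) (∈-allCuts S)

minFin-≤ : ∀ γ (h : Fin γ → ℚ) i → minFin γ h ≤ h i
minFin-≤ (suc zero)    h zero    = ℚ.≤-refl
minFin-≤ (suc (suc γ)) h zero    = ℚ.p⊓q≤p (h zero) _
minFin-≤ (suc (suc γ)) h (suc i) =
  ℚ.≤-trans (ℚ.p⊓q≤q (h zero) _) (minFin-≤ (suc γ) (λ j → h (suc j)) i)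

corollary4p7 : (n m γ k : ℕ) (G : SimpleGraph n m)
    (grp : Fin m → Fin γ)
    (nonempty : (i : Fin γ) → ∃ λ e → grp e ≡ i)
    (s : Fin (suc k) → Fin γ)
    (D : Dist n) → IsDistribution D →
    dfValue G γ grp D ≤ MP G (unionGroups grp s)
corollary4p7 n m γ k G grp nonempty s D distribution =
  ℚ.≤-trans (Equivalence.from (≤-expect-frac⇔rateAtLeast D v _ E′-nonempty) unionRate)
            (expect-≤ distribution (cutRatio-≤-MP G E′))
  where
  v = dfValue G γ grp D
  E′ = unionGroups grp s

  groupRate : ∀ i → RateAtLeast D v (card (group grp i)) (λ S → f G S (group grp i))
  groupRate i = Equivalence.to (≤-expect-frac⇔rateAtLeast D v _ Eᵢ-nonempty) (minFin-≤ γ _ i)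
    where
    Eᵢ-nonempty : 0 ℕ.< card (group grp i)
    Eᵢ-nonempty = card-pos _ (proj₁ (nonempty i)) (∈-group grp (proj₂ (nonempty i)))

  -- E′ is, by definition, the union of the groups i with selected i = true.
  selected : Fin γ → Bool
  selected i = any (λ j → ⌊ i ≟ s j ⌋) (allFin (suc k))

  unionRate : RateAtLeast D v (card E′) (λ S → f G S E′)
  unionRate = rateAtLeast-union G grp selected D v groupRate

  E′-nonempty : 0 ℕ.< card E′
  E′-nonempty = card-pos E′ _ (∈-unionGroups grp s zero (proj₂ (nonempty (s zero))))
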